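{- Let $G$ be a finite group, $H\leq G$, $T$ a right transversal of $H$ in $G$ containing $1$, and $\chi$ a linear character of $H$. For $t\in T$, the orbital $\mathcal{O}$ containing $(1,t)$ is orientable if and only if $\chi(tht^{ -1}h^{ -1})=1$ for all $h\in H\cap t^{ -1}Ht$.
   Context: Every $g\in G$ factors uniquely as $g=\mathfrak{h}(g)\mathfrak{t}(g)$ with $\mathfrak{h}(g)\in H$, $\mathfrak{t}(g)\in T$; put $U(g)=\chi(\mathfrak{h}(g))$. $G$ acts on $T\times T$ by $(s,t)\cdot g=(\mathfrak{t}(sg),\mathfrak{t}(tg))$; its orbits are the orbitals. The orbital $\mathcal{O}$ containing $(1,t)$ is orientable if for all $(u,v)\in\mathcal{O}$ and all $g,k\in Hu\cap t^{ -1}Hv$ one has $U(g)^{ -1}U(tg)=U(k)^{ -1}U(tk)$. -}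

module Defs where

open import Level using (Level; _⊔_; suc)
open import Algebra.Bundles using (Group; AbelianGroup)
open import Data.Nat using (ℕ)
open import Data.Fin using (Fin)
open import Data.Product using (Σ; Σ-syntax; ∃; ∃-syntax; _×_; _,_; proj₁; proj₂)
open import Relation.Unary using (Pred; _∈_)

IsFinite : ∀ {c ℓ} → Group c ℓ → Set (c ⊔ ℓ)
IsFinite G = Σ[ n ∈ ℕ ] Σ[ f ∈ (Fin n → Carrier) ] (∀ g → Σ[ i ∈ Fin n ] f i ≈ g)
  where open Group G

record IsSubgroup {c ℓ p} (G : Group c ℓ) (H : Pred (Group.Carrier G) p) : Set (c ⊔ ℓ ⊔ p) where
  open Group G
  field
    resp  : ∀ {x y} → x ≈ y → x ∈ H → y ∈ H
    ε∈    : ε ∈ H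
    ∙∈    : ∀ {x y} → x ∈ H → y ∈ H → (x ∙ y) ∈ H
    ⁻¹∈   : ∀ {x} → x ∈ H → (x ⁻¹) ∈ H

record IsRightTransversal {c ℓ p q} (G : Group c ℓ) (H : Pred (Group.Carrier G) p)
                          (T : Pred (Group.Carrier G) q) : Set (c ⊔ ℓ ⊔ p ⊔ q) where
  open Group G
  field
    respT     : ∀ {x y} → x ≈ y → x ∈ T → y ∈ T
    factor    : ∀ g → Σ[ h ∈ Carrier ] Σ[ t ∈ Carrier ] (h ∈ H × t ∈ T × g ≈ h ∙ t)
    unique    : ∀ {h t h′ t′} → h ∈ H → t ∈ T → h′ ∈ H → t′ ∈ T →
                h ∙ t ≈ h′ ∙ t′ → (h ≈ h′ × t ≈ t′)

  𝔥 : Carrier → Carrier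
  𝔥 g = proj₁ (factor g)

  𝔱 : Carrier → Carrier
  𝔱 g = proj₁ (proj₂ (factor g))

-- A linear character of H, with values in an abelian group A (standing in for ℂ^×):
-- a map χ (whose values off H are irrelevant) that is a homomorphism on H.
record IsLinearChar {c ℓ p a ℓa} (G : Group c ℓ) (H : Pred (Group.Carrier G) p)
                    (A : AbelianGroup a ℓa) (χ : Group.Carrier G → AbelianGroup.Carrier A)
                    : Set (c ⊔ ℓ ⊔ p ⊔ a ⊔ ℓa) where
  module G = Group G
  module A = AbelianGroup A
  field
    χ-cong : ∀ {x y} → x ∈ H → x G.≈ y → χ x A.≈ χ y
    χ-hom  : ∀ {x y} → x ∈ H → y ∈ H → χ (x G.∙ y) A.≈ (χ x A.∙ χ y)

module Setup {c ℓ p q a ℓa} (G : Group c ℓ) (H : Pred (Group.Carrier G) p)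
             (T : Pred (Group.Carrier G) q) (tr : IsRightTransversal G H T)
             (A : AbelianGroup a ℓa) (χ : Group.Carrier G → AbelianGroup.Carrier A) where
  open Group G
  open IsRightTransversal tr
  private module A = AbelianGroup A

  U : Carrier → A.Carrier
  U g = χ (𝔥 g)

  -- (u , v) lies in the orbital containing (1 , t): (u , v) = (1 , t) · g for some g,
  -- where (s , t) · g = (𝔱 (s g) , 𝔱 (t g)).
  InOrbital : Carrier → Carrier → Carrier → Set (c ⊔ ℓ)
  InOrbital t u v = Σ[ g ∈ Carrier ] (u ≈ 𝔱 (ε ∙ g) × v ≈ 𝔱 (t ∙ g))

  InHu∩t⁻¹Hv : Carrier → Carrier → Carrier → Carrier → Set (c ⊔ ℓ ⊔ p)
  InHu∩t⁻¹Hv t u v g = (Σ[ h ∈ Carrier ] (h ∈ H × g ≈ h ∙ u))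
                     × (Σ[ h ∈ Carrier ] (h ∈ H × g ≈ t ⁻¹ ∙ (h ∙ v)))

  Orientable : Carrier → Set (c ⊔ ℓ ⊔ p ⊔ ℓa)
  Orientable t = ∀ u v → InOrbital t u v → ∀ g k →
                 InHu∩t⁻¹Hv t u v g → InHu∩t⁻¹Hv t u v k →
                 (U g A.⁻¹ A.∙ U (t ∙ g)) A.≈ (U k A.⁻¹ A.∙ U (t ∙ k))

  InH∩t⁻¹Ht : Carrier → Carrier → Set (c ⊔ ℓ ⊔ p)
  InH∩t⁻¹Ht t h = h ∈ H × (Σ[ h′ ∈ Carrier ] (h′ ∈ H × h ≈ t ⁻¹ ∙ h′ ∙ t))

-- Put Δ(g) = U(g)⁻¹ U(tg). If g, k ∈ Hu ∩ t⁻¹Hv then k = xg and tk = y(tg) with x, y ∈ H,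
-- so tx = yt; hence x ∈ H ∩ t⁻¹Ht, and since U(xg) = χ(x) U(g) we get
-- Δ(k) = χ(y) χ(x)⁻¹ Δ(g) = χ(t x t⁻¹ x⁻¹) Δ(g). Conversely every h ∈ H ∩ t⁻¹Ht arises
-- this way from g = 1 and k = h, both lying in H𝔱(1) ∩ t⁻¹H𝔱(t).
module Submission where

open import Defs
open import Algebra.Bundles using (Group; AbelianGroup)
open import Relation.Unary using (Pred; _∈_)
open import Function.Bundles using (_⇔_; mk⇔)
open import Data.Product using (Σ-syntax; _×_; _,_; proj₁; proj₂)
import Algebra.Properties.Group as GroupProperties
import Algebra.Properties.AbelianGroup as AbelianGroupProperties
import Algebra.Solver.CommutativeMonoid as CommutativeMonoidSolver
import Relation.Binary.Reasoning.Setoid as SetoidReasoning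

module AbelianGroupLemmas {a ℓ} (A : AbelianGroup a ℓ) where
  open AbelianGroup A
  open AbelianGroupProperties A using (⁻¹-∙-comm)

  ⁻¹∙-interchange : ∀ x y z w → (x ∙ y) ⁻¹ ∙ (z ∙ w) ≈ (z ∙ x ⁻¹) ∙ (y ⁻¹ ∙ w)
  ⁻¹∙-interchange x y z w = trans (∙-congʳ (sym (⁻¹-∙-comm x y)))
    (solve 4 (λ a b c d → (a ⊕ b) ⊕ (c ⊕ d) ⊜ (c ⊕ a) ⊕ (b ⊕ d)) refl (x ⁻¹) (y ⁻¹) z w)
    where open CommutativeMonoidSolver commutativeMonoid

module GroupLemmas {c ℓ} (G : Group c ℓ) where
  open Group G
  open GroupProperties G
  open SetoidReasoning setoid

  commutator : Carrier → Carrier → Carrier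
  commutator t x = t ∙ x ∙ t ⁻¹ ∙ x ⁻¹

  sameRightCoset⇒translate : ∀ {a b p q w} → a ≈ p ∙ w → b ≈ q ∙ w → b ≈ q ∙ p ⁻¹ ∙ a
  sameRightCoset⇒translate {a} {b} {p} {q} {w} a≈pw b≈qw = begin
    b                    ≈⟨ b≈qw ⟩
    q ∙ w                ≈⟨ ∙-congˡ (\\-leftDividesʳ p w) ⟨
    q ∙ (p ⁻¹ ∙ (p ∙ w)) ≈⟨ assoc q (p ⁻¹) (p ∙ w) ⟨
    q ∙ p ⁻¹ ∙ (p ∙ w)   ≈⟨ ∙-congˡ a≈pw ⟨
    q ∙ p ⁻¹ ∙ a         ∎

  translate⇒conjugate : ∀ {t g k x y} → k ≈ x ∙ g → t ∙ k ≈ y ∙ (t ∙ g) → t ∙ x ≈ y ∙ t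
  translate⇒conjugate {t} {g} {k} {x} {y} k≈xg tk≈ytg = ∙-cancelʳ g (t ∙ x) (y ∙ t) (begin
    t ∙ x ∙ g   ≈⟨ assoc t x g ⟩
    t ∙ (x ∙ g) ≈⟨ ∙-congˡ k≈xg ⟨
    t ∙ k       ≈⟨ tk≈ytg ⟩
    y ∙ (t ∙ g) ≈⟨ assoc y t g ⟨
    y ∙ t ∙ g   ∎)

  conjugate⇒translate : ∀ {t g x y} → t ∙ x ≈ y ∙ t → t ∙ (x ∙ g) ≈ y ∙ (t ∙ g)
  conjugate⇒translate {t} {g} {x} {y} tx≈yt = begin
    t ∙ (x ∙ g) ≈⟨ assoc t x g ⟨
    t ∙ x ∙ g   ≈⟨ ∙-congʳ tx≈yt ⟩
    y ∙ t ∙ g   ≈⟨ assoc y t g ⟩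
    y ∙ (t ∙ g) ∎

  y≈x\\z⇒x∙y≈z : ∀ {x y z} → y ≈ x ⁻¹ ∙ z → x ∙ y ≈ z
  y≈x\\z⇒x∙y≈z {x} {y} {z} y≈x⁻¹z = trans (∙-congˡ y≈x⁻¹z) (\\-leftDividesˡ x z)

  conjugate⇒commutator : ∀ {t x y} → t ∙ x ≈ y ∙ t → commutator t x ≈ y ∙ x ⁻¹
  conjugate⇒commutator {t} {x} {y} tx≈yt =
    ∙-congʳ (trans (∙-congʳ tx≈yt) (//-rightDividesʳ t y))

  conjugate⇒conjugated : ∀ {t x y} → t ∙ x ≈ y ∙ t → x ≈ t ⁻¹ ∙ y ∙ t
  conjugate⇒conjugated {t} {x} {y} tx≈yt =
    trans (y≈x\\z t x (y ∙ t) tx≈yt) (sym (assoc (t ⁻¹) y t))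

  conjugated⇒conjugate : ∀ {t x y} → x ≈ t ⁻¹ ∙ y ∙ t → t ∙ x ≈ y ∙ t
  conjugated⇒conjugate {t} {x} {y} x≈t⁻¹yt = begin
    t ∙ x              ≈⟨ ∙-congˡ x≈t⁻¹yt ⟩
    t ∙ (t ⁻¹ ∙ y ∙ t) ≈⟨ assoc t (t ⁻¹ ∙ y) t ⟨
    t ∙ (t ⁻¹ ∙ y) ∙ t ≈⟨ ∙-congʳ (\\-leftDividesˡ t y) ⟩
    y ∙ t              ∎

module LinearCharLemmas {c ℓ p a ℓa} (G : Group c ℓ)
    {H : Pred (Group.Carrier G) p} (sub : IsSubgroup G H)
    (A : AbelianGroup a ℓa) {χ : Group.Carrier G → AbelianGroup.Carrier A}
    (lc : IsLinearChar G H A χ) where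
  open Group G
  open IsSubgroup sub
  open IsLinearChar lc using (χ-cong; χ-hom)
  private
    module A = AbelianGroup A
    module AP = GroupProperties A.group

  χ-ε : χ ε A.≈ A.ε
  χ-ε = AP.identityˡ-unique (χ ε) (χ ε)
    (A.trans (A.sym (χ-hom ε∈ ε∈)) (χ-cong (∙∈ ε∈ ε∈) (identityˡ ε)))

  χ-⁻¹ : ∀ {x} → x ∈ H → χ (x ⁻¹) A.≈ χ x A.⁻¹
  χ-⁻¹ {x} x∈H = AP.inverseʳ-unique (χ x) (χ (x ⁻¹))
    (A.trans (A.sym (χ-hom x∈H (⁻¹∈ x∈H))) (A.trans (χ-cong (∙∈ x∈H (⁻¹∈ x∈H)) (inverseʳ x)) χ-ε))

  χ-∙⁻¹ : ∀ {x y} → x ∈ H → y ∈ H → χ (x ∙ y ⁻¹) A.≈ χ x A.∙ χ y A.⁻¹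
  χ-∙⁻¹ x∈H y∈H = A.trans (χ-hom x∈H (⁻¹∈ y∈H)) (A.∙-congˡ (χ-⁻¹ y∈H))

module TransversalLemmas {c ℓ p q} (G : Group c ℓ)
    {H : Pred (Group.Carrier G) p} (sub : IsSubgroup G H)
    {T : Pred (Group.Carrier G) q} (tr : IsRightTransversal G H T) where
  open Group G
  open IsSubgroup sub
  open IsRightTransversal tr
  open SetoidReasoning setoid

  𝔥∈H : ∀ g → 𝔥 g ∈ H
  𝔥∈H g = proj₁ (proj₂ (proj₂ (factor g)))

  𝔱∈T : ∀ g → 𝔱 g ∈ T
  𝔱∈T g = proj₁ (proj₂ (proj₂ (proj₂ (factor g))))

  𝔥∙𝔱 : ∀ g → g ≈ 𝔥 g ∙ 𝔱 g
  𝔥∙𝔱 g = proj₂ (proj₂ (proj₂ (proj₂ (factor g))))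

  𝔥-equivariant : ∀ {g k x} → x ∈ H → k ≈ x ∙ g → 𝔥 k ≈ x ∙ 𝔥 g
  𝔥-equivariant {g} {k} {x} x∈H k≈xg =
    proj₁ (unique (𝔥∈H k) (𝔱∈T k) (∙∈ x∈H (𝔥∈H g)) (𝔱∈T g) (begin
      𝔥 k ∙ 𝔱 k       ≈⟨ 𝔥∙𝔱 k ⟨
      k               ≈⟨ k≈xg ⟩
      x ∙ g           ≈⟨ ∙-congˡ (𝔥∙𝔱 g) ⟩
      x ∙ (𝔥 g ∙ 𝔱 g) ≈⟨ assoc x (𝔥 g) (𝔱 g) ⟨
      x ∙ 𝔥 g ∙ 𝔱 g   ∎))

module Orientation {c ℓ p q a ℓa} (G : Group c ℓ)
    (H : Pred (Group.Carrier G) p) (sub : IsSubgroup G H)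
    (T : Pred (Group.Carrier G) q) (tr : IsRightTransversal G H T)
    (A : AbelianGroup a ℓa) (χ : Group.Carrier G → AbelianGroup.Carrier A)
    (lc : IsLinearChar G H A χ) (t : Group.Carrier G) where
  open Group G
  open IsSubgroup sub
  open IsRightTransversal tr
  open IsLinearChar lc using (χ-cong; χ-hom)
  open Setup G H T tr A χ
  open GroupLemmas G
  open GroupProperties G using (y≈x\\z)
  open LinearCharLemmas G sub A lc
  open TransversalLemmas G sub tr
  open AbelianGroupLemmas A
  private
    module A = AbelianGroup A
    module AP = GroupProperties A.group
  open SetoidReasoning A.setoid

  U-equivariant : ∀ {g k x} → x ∈ H → k ≈ x ∙ g → U k A.≈ χ x A.∙ U g
  U-equivariant {g} {k} x∈H k≈xg =
    A.trans (χ-cong (𝔥∈H k) (𝔥-equivariant x∈H k≈xg)) (χ-hom x∈H (𝔥∈H g))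

  Δ : Carrier → A.Carrier
  Δ g = U g A.⁻¹ A.∙ U (t ∙ g)

  Δ-translate : ∀ {g k x y} → x ∈ H → y ∈ H → k ≈ x ∙ g → t ∙ k ≈ y ∙ (t ∙ g) →
                Δ k A.≈ χ (commutator t x) A.∙ Δ g
  Δ-translate {g} {k} {x} {y} x∈H y∈H k≈xg tk≈ytg = begin
    U k A.⁻¹ A.∙ U (t ∙ k)                     ≈⟨ A.∙-cong (A.⁻¹-cong (U-equivariant x∈H k≈xg))
                                                            (U-equivariant y∈H tk≈ytg) ⟩
    (χ x A.∙ U g) A.⁻¹ A.∙ (χ y A.∙ U (t ∙ g)) ≈⟨ ⁻¹∙-interchange (χ x) (U g) (χ y) (U (t ∙ g)) ⟩
    (χ y A.∙ χ x A.⁻¹) A.∙ Δ g                 ≈⟨ A.∙-congʳ (χ-∙⁻¹ y∈H x∈H) ⟨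
    χ (y ∙ x ⁻¹) A.∙ Δ g                       ≈⟨ A.∙-congʳ (χ-cong [t,x]∈H [t,x]≈yx⁻¹) ⟨
    χ (commutator t x) A.∙ Δ g                 ∎
    where
    [t,x]≈yx⁻¹ : commutator t x ≈ y ∙ x ⁻¹
    [t,x]≈yx⁻¹ = conjugate⇒commutator (translate⇒conjugate k≈xg tk≈ytg)
    [t,x]∈H : commutator t x ∈ H
    [t,x]∈H = resp (sym [t,x]≈yx⁻¹) (∙∈ y∈H (⁻¹∈ x∈H))

  ∈Hu∩t⁻¹Hv-translate : ∀ {u v g x y} → x ∈ H → y ∈ H → t ∙ x ≈ y ∙ t →
                        InHu∩t⁻¹Hv t u v g → InHu∩t⁻¹Hv t u v (x ∙ g)
  ∈Hu∩t⁻¹Hv-translate {u} {v} {g} {x} {y} x∈H y∈H tx≈yt ((h , h∈H , g≈hu) , (h′ , h′∈H , g≈t⁻¹h′v)) =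
      (x ∙ h , ∙∈ x∈H h∈H , trans (∙-congˡ g≈hu) (sym (assoc x h u)))
    , (y ∙ h′ , ∙∈ y∈H h′∈H , y≈x\\z t (x ∙ g) (y ∙ h′ ∙ v)
        (trans (conjugate⇒translate tx≈yt)
          (trans (∙-congˡ (y≈x\\z⇒x∙y≈z g≈t⁻¹h′v)) (sym (assoc y h′ v)))))

  ∈H𝔱∩t⁻¹H𝔱 : ∀ g → InHu∩t⁻¹Hv t (𝔱 (ε ∙ g)) (𝔱 (t ∙ g)) g
  ∈H𝔱∩t⁻¹H𝔱 g = (𝔥 (ε ∙ g) , 𝔥∈H (ε ∙ g) , trans (sym (identityˡ g)) (𝔥∙𝔱 (ε ∙ g)))
               , (𝔥 (t ∙ g) , 𝔥∈H (t ∙ g) , y≈x\\z t g (𝔥 (t ∙ g) ∙ 𝔱 (t ∙ g)) (𝔥∙𝔱 (t ∙ g)))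

  ∈Hu∩t⁻¹Hv⇒translate : ∀ {u v g k} → InHu∩t⁻¹Hv t u v g → InHu∩t⁻¹Hv t u v k →
                        Σ[ x ∈ Carrier ] Σ[ y ∈ Carrier ]
                          (x ∈ H × y ∈ H × k ≈ x ∙ g × t ∙ k ≈ y ∙ (t ∙ g))
  ∈Hu∩t⁻¹Hv⇒translate ((h₁ , h₁∈H , g≈h₁u) , (h₁′ , h₁′∈H , g≈t⁻¹h₁′v))
                      ((h₂ , h₂∈H , k≈h₂u) , (h₂′ , h₂′∈H , k≈t⁻¹h₂′v)) =
      h₂ ∙ h₁ ⁻¹ , h₂′ ∙ h₁′ ⁻¹ , ∙∈ h₂∈H (⁻¹∈ h₁∈H) , ∙∈ h₂′∈H (⁻¹∈ h₁′∈H)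
    , sameRightCoset⇒translate g≈h₁u k≈h₂u
    , sameRightCoset⇒translate (y≈x\\z⇒x∙y≈z g≈t⁻¹h₁′v) (y≈x\\z⇒x∙y≈z k≈t⁻¹h₂′v)

  CommutatorCondition : Set _
  CommutatorCondition = ∀ h → InH∩t⁻¹Ht t h → χ (commutator t h) A.≈ A.ε

  orientable⇒commutatorCondition : Orientable t → CommutatorCondition
  orientable⇒commutatorCondition orientable h (h∈H , h′ , h′∈H , h≈t⁻¹h′t) =
    AP.identityˡ-unique (χ (commutator t h)) (Δ ε) (A.sym (begin
      Δ ε                        ≈⟨ orientable _ _ (ε , refl , refl) ε (h ∙ ε) base translated ⟩
      Δ (h ∙ ε)                  ≈⟨ Δ-translate h∈H h′∈H refl (conjugate⇒translate th≈h′t) ⟩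
      χ (commutator t h) A.∙ Δ ε ∎))
    where
    th≈h′t : t ∙ h ≈ h′ ∙ t
    th≈h′t = conjugated⇒conjugate h≈t⁻¹h′t
    base : InHu∩t⁻¹Hv t (𝔱 (ε ∙ ε)) (𝔱 (t ∙ ε)) ε
    base = ∈H𝔱∩t⁻¹H𝔱 ε
    translated : InHu∩t⁻¹Hv t (𝔱 (ε ∙ ε)) (𝔱 (t ∙ ε)) (h ∙ ε)
    translated = ∈Hu∩t⁻¹Hv-translate h∈H h′∈H th≈h′t base

  commutatorCondition⇒orientable : CommutatorCondition → Orientable t
  commutatorCondition⇒orientable condition u v _ g k g∈ k∈
    with x , y , x∈H , y∈H , k≈xg , tk≈ytg ← ∈Hu∩t⁻¹Hv⇒translate g∈ k∈ = A.sym (begin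
      Δ k                        ≈⟨ Δ-translate x∈H y∈H k≈xg tk≈ytg ⟩
      χ (commutator t x) A.∙ Δ g ≈⟨ A.∙-congʳ (condition x (x∈H , y , y∈H , conjugate⇒conjugated tx≈yt)) ⟩
      A.ε A.∙ Δ g                ≈⟨ A.identityˡ (Δ g) ⟩
      Δ g                        ∎)
    where
    tx≈yt : t ∙ x ≈ y ∙ t
    tx≈yt = translate⇒conjugate k≈xg tk≈ytg

proposition3p6 : ∀ {c ℓ p q a ℓa} (G : Group c ℓ) → IsFinite G →
    (H : Pred (Group.Carrier G) p) → IsSubgroup G H →
    (T : Pred (Group.Carrier G) q) → (tr : IsRightTransversal G H T) → Group.ε G ∈ T →
    (A : AbelianGroup a ℓa) → (χ : Group.Carrier G → AbelianGroup.Carrier A) → IsLinearChar G H A χ →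
    (t : Group.Carrier G) → t ∈ T →
    Setup.Orientable G H T tr A χ t
      ⇔ (∀ h → Setup.InH∩t⁻¹Ht G H T tr A χ t h →
           AbelianGroup._≈_ A (χ (Group._∙_ G (Group._∙_ G (Group._∙_ G t h) (Group._⁻¹ G t)) (Group._⁻¹ G h)))
                              (AbelianGroup.ε A))
proposition3p6 G _ H sub T tr _ A χ lc t _ =
  mk⇔ orientable⇒commutatorCondition commutatorCondition⇒orientable
  where open Orientation G H sub T tr A χ lc t
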